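{- If $w\in B_n$ avoids the signed patterns $1\bar2$, $\bar21$, $\bar2\bar1$, $312$, $3\bar12$, then $w$ avoids the (unsigned) patterns $3412$ and $4231$.
   Context: $[\bar n,n]=\{ -n,\dots,-1,1,\dots,n\}$, $\bar a=-a$. $B_n$ is the group of permutations $w$ of $[\bar n,n]$ with $w(\bar i)=\overline{w(i)}$; $w_i=w(i)$. Signed patterns: for a word $v_1\cdots v_k$ in $[\bar k,k]$ with $|v_1|\cdots|v_k|$ a permutation of $[k]$, a word $y_1\cdots y_k$ in $[\bar n,n]$ with distinct absolute values matches $v$ if $v_i,y_i$ have the same sign for all $i$ and $|v_i|<|v_j|\iff|y_i|<|y_j|$; $w$ avoids the signed pattern $v$ if no subsequence of $w_1\cdots w_n$ matches $v$. $w$ avoids the unsigned pattern $u\in S_k$ if no subsequence of the word $w_{\bar n}\cdots w_{\bar1}w_1\cdots w_n$ is order-isomorphic to $u$. -}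

module Defs where

open import Data.Nat as ℕ using (ℕ; suc)
open import Data.Integer as ℤ using (ℤ; +_; -[1+_]; -_; ∣_∣; sign; +[1+_])
open import Data.Fin as Fin using (Fin; toℕ; splitAt; opposite)
open import Data.Fin.Permutation using (Permutation′; _⟨$⟩ʳ_)
open import Data.Bool using (Bool; if_then_else_)
open import Data.Sum using (inj₁; inj₂)
open import Data.Vec using (Vec; lookup; []; _∷_)
open import Data.Product using (∃; _×_)
open import Relation.Binary.PropositionalEquality using (_≡_)
open import Relation.Nullary using (¬_)
open import Function.Bundles using (_⇔_)

-- An element of B_n: a permutation σ of [n] (0-indexed as Fin n) and a sign for each position.
-- Its value at position i+1 is  ±(σ(i)+1); w(ī) = -w(i) is then determined.
record SignedPerm (n : ℕ) : Set where
  field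
    perm : Permutation′ n
    neg  : Fin n → Bool

val : ∀ {n} → SignedPerm n → Fin n → ℤ
val w i = if SignedPerm.neg w i then -[1+ toℕ (SignedPerm.perm w ⟨$⟩ʳ i) ]
          else +[1+ toℕ (SignedPerm.perm w ⟨$⟩ʳ i) ]

-- The word w_{n̄} ⋯ w_{1̄} w_1 ⋯ w_n, of length 2n, indexed by Fin (n + n).
fullWord : ∀ {n} → SignedPerm n → Fin (n ℕ.+ n) → ℤ
fullWord {n} w j with splitAt n j
... | inj₁ a = - val w (opposite a)
... | inj₂ b = val w b

Increasing : ∀ {k m} → (Fin k → Fin m) → Set
Increasing f = ∀ a b → a Fin.< b → f a Fin.< f b

MatchesSigned : ∀ {k} → Vec ℤ k → (Fin k → ℤ) → Set
MatchesSigned {k} v y =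
  (∀ a → sign (lookup v a) ≡ sign (y a)) ×
  (∀ a b → (∣ lookup v a ∣ ℕ.< ∣ lookup v b ∣) ⇔ (∣ y a ∣ ℕ.< ∣ y b ∣))

AvoidsSigned : ∀ {n k} → SignedPerm n → Vec ℤ k → Set
AvoidsSigned {n} {k} w v =
  ¬ ∃ λ (f : Fin k → Fin n) → Increasing f × MatchesSigned v (λ a → val w (f a))

OrderIso : ∀ {k} → Vec ℕ k → (Fin k → ℤ) → Set
OrderIso {k} u y = ∀ a b → (lookup u a ℕ.< lookup u b) ⇔ (y a ℤ.< y b)

AvoidsUnsigned : ∀ {n k} → SignedPerm n → Vec ℕ k → Set
AvoidsUnsigned {n} {k} w u =
  ¬ ∃ λ (f : Fin k → Fin (n ℕ.+ n)) → Increasing f × OrderIso u (λ a → fullWord w (f a))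

p1b2 : Vec ℤ 2
p1b2 = + 1 ∷ - (+ 2) ∷ []
pb21 : Vec ℤ 2
pb21 = - (+ 2) ∷ + 1 ∷ []
pb2b1 : Vec ℤ 2
pb2b1 = - (+ 2) ∷ - (+ 1) ∷ []
p312 : Vec ℤ 3
p312 = + 3 ∷ + 1 ∷ + 2 ∷ []
p3b12 : Vec ℤ 3
p3b12 = + 3 ∷ - (+ 1) ∷ + 2 ∷ []

u3412 : Vec ℕ 4
u3412 = 3 ∷ 4 ∷ 1 ∷ 2 ∷ []
u4231 : Vec ℕ 4
u4231 = 4 ∷ 2 ∷ 3 ∷ 1 ∷ []

-- Sort the letters of w_{n̄} ⋯ w_{1̄} w_1 ⋯ w_n into three layers: low = the letters -w_i with
-- w_i > 0 (all in the barred half), mid = the letters ±w_i with w_i < 0, high = the letters w_i > 0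
-- (all in the plain half). Avoiding 1 2̄ and 2̄ 1 puts every negative entry of w below every positive
-- one in absolute value, so layers increase with value; avoiding 2̄ 1̄ makes the mid layer
-- decreasing; avoiding 312 and 3 1̄ 2 forbids 312 in the high layer, 231 in the low layer, and a
-- descent between two high (or two low) letters around a mid one. In an occurrence of 3412 or 4231
-- the layers increase weakly with the values, and each of the few such layer assignments breaks one
-- of these rules.
module Submission where

open import Defs
open import Data.Nat as ℕ using (ℕ; suc; s<s; _≮_; _<ᵇ_)
open import Data.Nat.Properties as ℕ using (≤∧≢⇒<; ≮⇒≥; <⇒<ᵇ; n<1+n; ∸-monoʳ-<; +-cancelˡ-<; m≤m+n)
open import Data.Integer as ℤ using (ℤ; -[1+_]; +[1+_]; -_; ∣_∣; sign)
open import Data.Integer.Properties using (<-trans; drop‿+<+; drop‿-<-)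
open import Data.Sign as Sign using ()
open import Data.Fin as Fin using (Fin; toℕ; splitAt; opposite)
open import Data.Fin.Patterns using (0F; 1F; 2F; 3F)
open import Data.Fin.Properties as Fin
  using (toℕ-injective; all?; <⇒≢; toℕ-↑ˡ; toℕ-↑ʳ; toℕ<n; opposite-prop; splitAt⁻¹-↑ˡ; splitAt⁻¹-↑ʳ)
open import Data.Fin.Permutation using (_⟨$⟩ʳ_)
open import Data.Bool using (true; false; T)
open import Data.Vec using (Vec; lookup; []; _∷_)
open import Data.Sum using (inj₁; inj₂)
open import Data.Product using (∃; _×_; _,_; proj₁; proj₂)
open import Data.Unit using (⊤; tt)
open import Data.Empty using (⊥; ⊥-elim)
open import Relation.Binary.PropositionalEquality using (_≡_; _≢_; refl; sym; trans; cong; subst₂)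
open import Relation.Binary.Definitions using (tri<; tri≈; tri>)
open import Relation.Nullary using (¬_; Dec)
open import Relation.Nullary.Decidable using (True; toWitness; _→-dec_)
open import Function using (_∘_)
open import Function.Bundles using (Injection; Equivalence; _⇔_; mk⇔)
open import Function.Properties.Inverse using (↔⇒↣)

data Layer : Set where
  low mid high : Layer

data _≼_ : Layer → Layer → Set where
  low≼    : ∀ {ℓ} → low ≼ ℓ
  mid≼mid : mid ≼ mid
  ≼high   : ∀ {ℓ} → ℓ ≼ high

record Layering {P : Set} (_⊏_ : P → P → Set) (x : P → ℤ) : Set₁ where
  field
    _∈_        : P → Layer → Set
    layer      : ∀ p → ∃ (p ∈_)
    layer-mono : ∀ {p q ℓ ℓ′} → p ∈ ℓ → q ∈ ℓ′ → x p ℤ.< x q → ℓ ≼ ℓ′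
    no-high-before-low : ∀ {p q} → p ⊏ q → p ∈ high → q ∈ low → ⊥
    no-mid-ascent      : ∀ {p q} → p ⊏ q → p ∈ mid → q ∈ mid → x p ℤ.< x q → ⊥
    no-high-mid-high-descent : ∀ {p q r} → p ⊏ q → q ⊏ r →
      p ∈ high → q ∈ mid → r ∈ high → x r ℤ.< x p → ⊥
    no-low-mid-low-descent : ∀ {p q r} → p ⊏ q → q ⊏ r →
      p ∈ low → q ∈ mid → r ∈ low → x r ℤ.< x p → ⊥
    high-avoids-312 : ∀ {p q r} → p ⊏ q → q ⊏ r →
      p ∈ high → q ∈ high → r ∈ high → x q ℤ.< x r → x r ℤ.< x p → ⊥
    low-avoids-231 : ∀ {p q r} → p ⊏ q → q ⊏ r →
      p ∈ low → q ∈ low → r ∈ low → x r ℤ.< x p → x p ℤ.< x q → ⊥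

Avoids : ∀ {P : Set} (_⊏_ : P → P → Set) (x : P → ℤ) {k} → Vec ℕ k → Set
Avoids {P} _⊏_ x {k} u =
  ¬ ∃ λ (q : Fin k → P) → (∀ a b → a Fin.< b → q a ⊏ q b) × OrderIso u (x ∘ q)

module _ {P : Set} {_⊏_ : P → P → Set} {x : P → ℤ} (L : Layering _⊏_ x) where
  open Layering L

  private
    module Occurrence (u : Vec ℕ 4) (q : Fin 4 → P) (q-mono : ∀ a b → a Fin.< b → q a ⊏ q b)
                      (iso : OrderIso u (x ∘ q)) where
      e : ∀ a → q a ∈ proj₁ (layer (q a))
      e a = proj₂ (layer (q a))

      o₁₂ : q 0F ⊏ q 1F
      o₁₂ = q-mono 0F 1F (n<1+n 0)
      o₂₃ : q 1F ⊏ q 2F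
      o₂₃ = q-mono 1F 2F (n<1+n 1)
      o₃₄ : q 2F ⊏ q 3F
      o₃₄ = q-mono 2F 3F (n<1+n 2)

      rise : ∀ a b → lookup u a ℕ.< lookup u b → x (q a) ℤ.< x (q b)
      rise a b = Equivalence.to (iso a b)

  -- In both proofs the clauses of by-layers only list monotone layer assignments: the others are
  -- excluded by the three ≼ arguments.
  layering-avoids-3412 : Avoids _⊏_ x u3412
  layering-avoids-3412 (q , q-mono , iso) =
    by-layers (e 0F) (e 1F) (e 2F) (e 3F)
       (layer-mono (e 2F) (e 3F) v₃₄) (layer-mono (e 3F) (e 0F) v₄₁) (layer-mono (e 0F) (e 1F) v₁₂)
    where
    open Occurrence u3412 q q-mono iso
    v₃₄ : x (q 2F) ℤ.< x (q 3F)
    v₃₄ = rise 2F 3F (n<1+n 1)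
    v₄₁ : x (q 3F) ℤ.< x (q 0F)
    v₄₁ = rise 3F 0F (n<1+n 2)
    v₁₂ : x (q 0F) ℤ.< x (q 1F)
    v₁₂ = rise 0F 1F (n<1+n 3)
    v₃₁ : x (q 2F) ℤ.< x (q 0F)
    v₃₁ = <-trans v₃₄ v₄₁
    v₄₂ : x (q 3F) ℤ.< x (q 1F)
    v₄₂ = <-trans v₄₁ v₁₂
    by-layers : ∀ {ℓ₁ ℓ₂ ℓ₃ ℓ₄} → q 0F ∈ ℓ₁ → q 1F ∈ ℓ₂ → q 2F ∈ ℓ₃ → q 3F ∈ ℓ₄ →
                ℓ₃ ≼ ℓ₄ → ℓ₄ ≼ ℓ₁ → ℓ₁ ≼ ℓ₂ → ⊥
    by-layers {ℓ₂ = high} {ℓ₃ = low} _ e₂ e₃ _ _ _ _ = no-high-before-low o₂₃ e₂ e₃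
    by-layers {ℓ₁ = mid} {ℓ₂ = mid} e₁ e₂ _ _ _ _ _ = no-mid-ascent o₁₂ e₁ e₂ v₁₂
    by-layers {ℓ₃ = mid} {ℓ₄ = mid} _ _ e₃ e₄ _ _ _ = no-mid-ascent o₃₄ e₃ e₄ v₃₄
    by-layers {ℓ₁ = low} {ℓ₂ = mid} {ℓ₃ = low} e₁ e₂ e₃ _ _ _ _ =
      no-low-mid-low-descent o₁₂ o₂₃ e₁ e₂ e₃ v₃₁
    by-layers {ℓ₁ = low} {ℓ₂ = low} {ℓ₃ = low} e₁ e₂ e₃ _ _ _ _ =
      low-avoids-231 o₁₂ o₂₃ e₁ e₂ e₃ v₃₁ v₁₂
    by-layers {ℓ₂ = high} {ℓ₃ = mid} {ℓ₄ = high} _ e₂ e₃ e₄ _ _ _ =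
      no-high-mid-high-descent o₂₃ o₃₄ e₂ e₃ e₄ v₄₂
    by-layers {ℓ₂ = high} {ℓ₃ = high} {ℓ₄ = high} _ e₂ e₃ e₄ _ _ _ =
      high-avoids-312 o₂₃ o₃₄ e₂ e₃ e₄ v₃₄ v₄₂

  layering-avoids-4231 : Avoids _⊏_ x u4231
  layering-avoids-4231 (q , q-mono , iso) =
    by-layers (e 0F) (e 1F) (e 2F) (e 3F)
       (layer-mono (e 3F) (e 1F) v₄₂) (layer-mono (e 1F) (e 2F) v₂₃) (layer-mono (e 2F) (e 0F) v₃₁)
    where
    open Occurrence u4231 q q-mono iso
    v₄₂ : x (q 3F) ℤ.< x (q 1F)
    v₄₂ = rise 3F 1F (n<1+n 1)
    v₂₃ : x (q 1F) ℤ.< x (q 2F)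
    v₂₃ = rise 1F 2F (n<1+n 2)
    v₃₁ : x (q 2F) ℤ.< x (q 0F)
    v₃₁ = rise 2F 0F (n<1+n 3)
    by-layers : ∀ {ℓ₁ ℓ₂ ℓ₃ ℓ₄} → q 0F ∈ ℓ₁ → q 1F ∈ ℓ₂ → q 2F ∈ ℓ₃ → q 3F ∈ ℓ₄ →
                ℓ₄ ≼ ℓ₂ → ℓ₂ ≼ ℓ₃ → ℓ₃ ≼ ℓ₁ → ⊥
    by-layers {ℓ₃ = high} {ℓ₄ = low} _ _ e₃ e₄ _ _ _ = no-high-before-low o₃₄ e₃ e₄
    by-layers {ℓ₂ = mid} {ℓ₃ = mid} _ e₂ e₃ _ _ _ _ = no-mid-ascent o₂₃ e₂ e₃ v₂₃
    by-layers {ℓ₂ = low} {ℓ₃ = mid} {ℓ₄ = low} _ e₂ e₃ e₄ _ _ _ =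
      no-low-mid-low-descent o₂₃ o₃₄ e₂ e₃ e₄ v₄₂
    by-layers {ℓ₂ = low} {ℓ₃ = low} {ℓ₄ = low} _ e₂ e₃ e₄ _ _ _ =
      low-avoids-231 o₂₃ o₃₄ e₂ e₃ e₄ v₄₂ v₂₃
    by-layers {ℓ₁ = high} {ℓ₂ = mid} {ℓ₃ = high} e₁ e₂ e₃ _ _ _ _ =
      no-high-mid-high-descent o₁₂ o₂₃ e₁ e₂ e₃ v₃₁
    by-layers {ℓ₁ = high} {ℓ₂ = high} {ℓ₃ = high} e₁ e₂ e₃ _ _ _ _ =
      high-avoids-312 o₁₂ o₂₃ e₁ e₂ e₃ v₂₃ v₃₁

increasing₂ : ∀ {m} {i j : Fin m} → i Fin.< j → Increasing (lookup (i ∷ j ∷ []))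
increasing₂ i<j 0F 1F _ = i<j
increasing₂ _   1F 1F (s<s ())

increasing₃ : ∀ {m} {i j k : Fin m} → i Fin.< j → j Fin.< k → Increasing (lookup (i ∷ j ∷ k ∷ []))
increasing₃ i<j j<k 0F 1F _ = i<j
increasing₃ i<j j<k 0F 2F _ = Fin.<-trans i<j j<k
increasing₃ i<j j<k 1F 2F _ = j<k
increasing₃ _   _   1F 1F (s<s ())
increasing₃ _   _   2F 2F (s<s (s<s ()))

AbsInjective : ∀ {k} → Vec ℤ k → Set
AbsInjective v = ∀ a b → ∣ lookup v a ∣ ≡ ∣ lookup v b ∣ → a ≡ b

absInjective? : ∀ {k} (v : Vec ℤ k) → Dec (AbsInjective v)
absInjective? v = all? λ a → all? λ b → (∣ lookup v a ∣ ℕ.≟ ∣ lookup v b ∣) →-dec (a Fin.≟ b)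

module _ {n : ℕ} (w : SignedPerm n) where
  open SignedPerm w

  mag : Fin n → ℕ
  mag i = toℕ (perm ⟨$⟩ʳ i)

  mag-injective : ∀ {i j} → mag i ≡ mag j → i ≡ j
  mag-injective = Injection.injective (↔⇒↣ perm) ∘ toℕ-injective

  Positive Negative : Fin n → Set
  Positive i = neg i ≡ false
  Negative i = neg i ≡ true

  val-positive : ∀ {i} → Positive i → val w i ≡ +[1+ mag i ]
  val-positive p rewrite p = refl

  val-negative : ∀ {i} → Negative i → val w i ≡ -[1+ mag i ]
  val-negative q rewrite q = refl

  ∣val∣ : ∀ i → ∣ val w i ∣ ≡ suc (mag i)
  ∣val∣ i with neg i
  ... | true  = refl
  ... | false = refl

  sign-positive : ∀ {i} → Positive i → Sign.+ ≡ sign (val w i)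
  sign-positive p = cong sign (sym (val-positive p))

  sign-negative : ∀ {i} → Negative i → Sign.- ≡ sign (val w i)
  sign-negative q = cong sign (sym (val-negative q))

  positive≢negative : ∀ {i j} → Positive i → Negative j → i ≢ j
  positive≢negative p q refl with trans (sym p) q
  ... | ()

  mag-< : ∀ {i j} → i ≢ j → mag j ≮ mag i → mag i ℕ.< mag j
  mag-< i≢j j≮i = ≤∧≢⇒< (≮⇒≥ j≮i) (i≢j ∘ mag-injective)

  -- Only the comparisons that v prescribes have to be supplied: since the absolute values of v are
  -- distinct, the reverse implications follow by trichotomy.
  matchesSigned : ∀ {k} (v : Vec ℤ k) {_ : True (absInjective? v)} (g : Fin k → Fin n) →
    (∀ a → sign (lookup v a) ≡ sign (val w (g a))) →
    (∀ a b → T (∣ lookup v a ∣ <ᵇ ∣ lookup v b ∣) → mag (g a) ℕ.< mag (g b)) →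
    MatchesSigned v (val w ∘ g)
  matchesSigned v {inj} g signs mono = signs , λ a b → mk⇔ (to a b) (from a b)
    where
    to : ∀ a b → ∣ lookup v a ∣ ℕ.< ∣ lookup v b ∣ → ∣ val w (g a) ∣ ℕ.< ∣ val w (g b) ∣
    to a b lt = subst₂ ℕ._<_ (sym (∣val∣ (g a))) (sym (∣val∣ (g b)))
                  (s<s (mono a b (<⇒<ᵇ lt)))
    from : ∀ a b → ∣ val w (g a) ∣ ℕ.< ∣ val w (g b) ∣ → ∣ lookup v a ∣ ℕ.< ∣ lookup v b ∣
    from a b lt with ℕ.<-cmp ∣ lookup v a ∣ ∣ lookup v b ∣
    ... | tri< v<v _ _ = v<v
    ... | tri≈ _ v≡v _ rewrite toWitness inj a b v≡v = ⊥-elim (ℕ.<-irrefl refl lt)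
    ... | tri> _ _ v>v = ⊥-elim (ℕ.<-asym lt (to b a v>v))

  NegativesBelowPositives : Set
  NegativesBelowPositives = ∀ {i j} → Negative i → Positive j → mag i ℕ.< mag j

  negativesBelowPositives : AvoidsSigned w p1b2 → AvoidsSigned w pb21 → NegativesBelowPositives
  negativesBelowPositives av1b2 avb21 {i} {j} qi pj = mag-< (positive≢negative pj qi ∘ sym) j≮ₘi
    where
    j≮ₘi : mag j ≮ mag i
    j≮ₘi j<ₘi with Fin.<-cmp i j
    ... | tri< i<j _ _ = avb21 (lookup (i ∷ j ∷ []) , increasing₂ i<j ,
          matchesSigned pb21 _ (λ { 0F → sign-negative qi ; 1F → sign-positive pj })
            λ { 1F 0F _ → j<ₘi ; 0F 0F () ; 0F 1F () ; 1F 1F () })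
    ... | tri≈ _ refl _ = positive≢negative pj qi refl
    ... | tri> _ _ j<i = av1b2 (lookup (j ∷ i ∷ []) , increasing₂ j<i ,
          matchesSigned p1b2 _ (λ { 0F → sign-positive pj ; 1F → sign-negative qi })
            λ { 0F 1F _ → j<ₘi ; 0F 0F () ; 1F 0F () ; 1F 1F () })

  negatives-ascend : AvoidsSigned w pb2b1 → ∀ {i j} → i Fin.< j → Negative i → Negative j →
    mag i ℕ.< mag j
  negatives-ascend avb2b1 {i} {j} i<j qi qj = mag-< (<⇒≢ i<j) λ j<ₘi →
    avb2b1 (lookup (i ∷ j ∷ []) , increasing₂ i<j ,
      matchesSigned pb2b1 _ (λ { 0F → sign-negative qi ; 1F → sign-negative qj })
        λ { 1F 0F _ → j<ₘi ; 0F 0F () ; 0F 1F () ; 1F 1F () })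

  positives-avoid-312 : AvoidsSigned w p312 → ∀ {i j k} → i Fin.< j → j Fin.< k →
    Positive i → Positive j → Positive k → mag j ℕ.< mag k → mag k ℕ.< mag i → ⊥
  positives-avoid-312 av312 {i} {j} {k} i<j j<k pi pj pk j<ₘk k<ₘi =
    av312 (lookup (i ∷ j ∷ k ∷ []) , increasing₃ i<j j<k ,
      matchesSigned p312 _
        (λ { 0F → sign-positive pi ; 1F → sign-positive pj ; 2F → sign-positive pk })
        λ { 1F 0F _ → ℕ.<-trans j<ₘk k<ₘi ; 2F 0F _ → k<ₘi ; 1F 2F _ → j<ₘk
          ; 0F 0F () ; 0F 1F () ; 0F 2F () ; 1F 1F () ; 2F 1F () ; 2F 2F () })

  positives-ascend-across-negative : NegativesBelowPositives → AvoidsSigned w p3b12 →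
    ∀ {i j k} → i Fin.< j → j Fin.< k → Positive i → Negative j → Positive k → mag i ℕ.< mag k
  positives-ascend-across-negative neg<pos av3b12 {i} {j} {k} i<j j<k pi qj pk =
    mag-< (<⇒≢ (Fin.<-trans i<j j<k)) λ k<ₘi →
      av3b12 (lookup (i ∷ j ∷ k ∷ []) , increasing₃ i<j j<k ,
        matchesSigned p3b12 _
          (λ { 0F → sign-positive pi ; 1F → sign-negative qj ; 2F → sign-positive pk })
          λ { 1F 0F _ → neg<pos qj pi ; 2F 0F _ → k<ₘi ; 1F 2F _ → neg<pos qj pk
            ; 0F 0F () ; 0F 1F () ; 0F 2F () ; 1F 1F () ; 2F 1F () ; 2F 2F () })

opposite-< : ∀ {n} {i j : Fin n} → i Fin.< j → opposite j Fin.< opposite i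
opposite-< {i = i} {j} i<j = subst₂ ℕ._<_ (sym (opposite-prop j)) (sym (opposite-prop i))
  (∸-monoʳ-< (s<s i<j) (toℕ<n j))

splitAt-inj₁-toℕ : ∀ {m n} {p : Fin (m ℕ.+ n)} {a} → splitAt m p ≡ inj₁ a → toℕ p ≡ toℕ a
splitAt-inj₁-toℕ {n = n} {a = a} e = trans (cong toℕ (sym (splitAt⁻¹-↑ˡ e))) (toℕ-↑ˡ a n)

splitAt-inj₂-toℕ : ∀ {m n} {p : Fin (m ℕ.+ n)} {b} → splitAt m p ≡ inj₂ b → toℕ p ≡ m ℕ.+ toℕ b
splitAt-inj₂-toℕ {m} {b = b} e = trans (cong toℕ (sym (splitAt⁻¹-↑ʳ e))) (toℕ-↑ʳ m b)

-- barred i is the position of w_{ī} in w_{n̄} ⋯ w_{1̄} w_1 ⋯ w_n, and plain i that of w_i.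
data Position (n : ℕ) : Set where
  barred plain : Fin n → Position n

_⊏_ : ∀ {n} → Position n → Position n → Set
barred i ⊏ barred j = j Fin.< i
barred _ ⊏ plain  _ = ⊤
plain  _ ⊏ barred _ = ⊥
plain  i ⊏ plain  j = i Fin.< j

position : ∀ {n} → Fin (n ℕ.+ n) → Position n
position {n} p with splitAt n p
... | inj₁ a = barred (opposite a)
... | inj₂ b = plain b

position-mono : ∀ {n} {p q : Fin (n ℕ.+ n)} → p Fin.< q → position {n} p ⊏ position q
position-mono {n} {p} {q} p<q with splitAt n p in ep | splitAt n q in eq
... | inj₁ a | inj₁ b =
  opposite-< (subst₂ ℕ._<_ (splitAt-inj₁-toℕ ep) (splitAt-inj₁-toℕ eq) p<q)
... | inj₁ _ | inj₂ _ = tt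
... | inj₂ a | inj₁ b = ℕ.<-asym (subst₂ ℕ._<_ (splitAt-inj₂-toℕ ep) (splitAt-inj₁-toℕ eq) p<q)
                                 (ℕ.<-≤-trans (toℕ<n b) (m≤m+n n (toℕ a)))
... | inj₂ a | inj₂ b =
  +-cancelˡ-< n (toℕ a) (toℕ b) (subst₂ ℕ._<_ (splitAt-inj₂-toℕ ep) (splitAt-inj₂-toℕ eq) p<q)

entry : ∀ {n} → SignedPerm n → Position n → ℤ
entry w (barred i) = - val w i
entry w (plain  i) = val w i

fullWord-position : ∀ {n} (w : SignedPerm n) p → fullWord w p ≡ entry w (position p)
fullWord-position {n} w p with splitAt n p
... | inj₁ _ = refl
... | inj₂ _ = refl

avoidsUnsigned-via-positions : ∀ {n k} (w : SignedPerm n) (u : Vec ℕ k) →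
  Avoids _⊏_ (entry w) u → AvoidsUnsigned w u
avoidsUnsigned-via-positions {n} w u avoids (f , f-mono , iso) =
  avoids (position ∘ f , (λ a b → position-mono {n} ∘ f-mono a b) , iso′)
  where
  iso′ : OrderIso u (entry w ∘ position ∘ f)
  iso′ a b = subst₂ (λ s t → (lookup u a ℕ.< lookup u b) ⇔ (s ℤ.< t))
               (fullWord-position w (f a)) (fullWord-position w (f b)) (iso a b)

+[1+]-cancel-< : ∀ {a b} → +[1+ a ] ℤ.< +[1+ b ] → a ℕ.< b
+[1+]-cancel-< = ℕ.s<s⁻¹ ∘ drop‿+<+

module _ {n : ℕ} (w : SignedPerm n) where

  data InLayer : Position n → Layer → Set where
    low-barred : ∀ {i} → Positive w i → InLayer (barred i) low
    mid-barred : ∀ {i} → Negative w i → InLayer (barred i) mid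
    mid-plain  : ∀ {i} → Negative w i → InLayer (plain i) mid
    high-plain : ∀ {i} → Positive w i → InLayer (plain i) high

  inLayer : ∀ p → ∃ (InLayer p)
  inLayer (barred i) with SignedPerm.neg w i in e
  ... | false = low , low-barred e
  ... | true  = mid , mid-barred e
  inLayer (plain i) with SignedPerm.neg w i in e
  ... | false = high , high-plain e
  ... | true  = mid , mid-plain e

  entry-low : ∀ {i} → Positive w i → entry w (barred i) ≡ -[1+ mag w i ]
  entry-low p = cong -_ (val-positive w p)

  entry-mid-barred : ∀ {i} → Negative w i → entry w (barred i) ≡ +[1+ mag w i ]
  entry-mid-barred q = cong -_ (val-negative w q)

  entry-mid-plain : ∀ {i} → Negative w i → entry w (plain i) ≡ -[1+ mag w i ]
  entry-mid-plain = val-negative w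

  entry-high : ∀ {i} → Positive w i → entry w (plain i) ≡ +[1+ mag w i ]
  entry-high = val-positive w

module _ {n : ℕ} (w : SignedPerm n)
         (av1b2 : AvoidsSigned w p1b2) (avb21 : AvoidsSigned w pb21) (avb2b1 : AvoidsSigned w pb2b1)
         (av312 : AvoidsSigned w p312) (av3b12 : AvoidsSigned w p3b12) where

  private
    neg<pos : NegativesBelowPositives w
    neg<pos = negativesBelowPositives w av1b2 avb21

    x : Position n → ℤ
    x = entry w

  layer-mono : ∀ {p q ℓ ℓ′} → InLayer w p ℓ → InLayer w q ℓ′ → x p ℤ.< x q → ℓ ≼ ℓ′
  layer-mono (low-barred _) _ _ = low≼
  layer-mono _ (high-plain _) _ = ≼high
  layer-mono (mid-barred _) (mid-barred _) _ = mid≼mid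
  layer-mono (mid-barred _) (mid-plain _) _ = mid≼mid
  layer-mono (mid-plain _) (mid-barred _) _ = mid≼mid
  layer-mono (mid-plain _) (mid-plain _) _ = mid≼mid
  layer-mono (mid-barred q) (low-barred p) lt
    with () ← subst₂ ℤ._<_ (entry-mid-barred w q) (entry-low w p) lt
  layer-mono (mid-plain q) (low-barred p) lt = ⊥-elim (ℕ.<-asym (neg<pos q p)
    (drop‿-<- (subst₂ ℤ._<_ (entry-mid-plain w q) (entry-low w p) lt)))
  layer-mono (high-plain p) (low-barred p′) lt
    with () ← subst₂ ℤ._<_ (entry-high w p) (entry-low w p′) lt
  layer-mono (high-plain p) (mid-barred q) lt = ⊥-elim (ℕ.<-asym (neg<pos q p)
    (+[1+]-cancel-< (subst₂ ℤ._<_ (entry-high w p) (entry-mid-barred w q) lt)))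
  layer-mono (high-plain p) (mid-plain q) lt
    with () ← subst₂ ℤ._<_ (entry-high w p) (entry-mid-plain w q) lt

  no-high-before-low : ∀ {p q} → p ⊏ q → InLayer w p high → InLayer w q low → ⊥
  no-high-before-low () (high-plain _) (low-barred _)

  no-mid-ascent : ∀ {p q} → p ⊏ q → InLayer w p mid → InLayer w q mid → x p ℤ.< x q → ⊥
  no-mid-ascent j<i (mid-barred qi) (mid-barred qj) lt =
    ℕ.<-asym (negatives-ascend w avb2b1 j<i qj qi)
             (+[1+]-cancel-< (subst₂ ℤ._<_ (entry-mid-barred w qi) (entry-mid-barred w qj) lt))
  no-mid-ascent _ (mid-barred qi) (mid-plain qj) lt
    with () ← subst₂ ℤ._<_ (entry-mid-barred w qi) (entry-mid-plain w qj) lt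
  no-mid-ascent () (mid-plain _) (mid-barred _) _
  no-mid-ascent i<j (mid-plain qi) (mid-plain qj) lt =
    ℕ.<-asym (negatives-ascend w avb2b1 i<j qi qj)
             (drop‿-<- (subst₂ ℤ._<_ (entry-mid-plain w qi) (entry-mid-plain w qj) lt))

  no-high-mid-high-descent : ∀ {p q r} → p ⊏ q → q ⊏ r →
    InLayer w p high → InLayer w q mid → InLayer w r high → x r ℤ.< x p → ⊥
  no-high-mid-high-descent () _ (high-plain _) (mid-barred _) _ _
  no-high-mid-high-descent i<j j<k (high-plain pi) (mid-plain qj) (high-plain pk) lt =
    ℕ.<-asym (positives-ascend-across-negative w neg<pos av3b12 i<j j<k pi qj pk)
             (+[1+]-cancel-< (subst₂ ℤ._<_ (entry-high w pk) (entry-high w pi) lt))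

  no-low-mid-low-descent : ∀ {p q r} → p ⊏ q → q ⊏ r →
    InLayer w p low → InLayer w q mid → InLayer w r low → x r ℤ.< x p → ⊥
  no-low-mid-low-descent j<i k<j (low-barred pi) (mid-barred qj) (low-barred pk) lt =
    ℕ.<-asym (positives-ascend-across-negative w neg<pos av3b12 k<j j<i pk qj pi)
             (drop‿-<- (subst₂ ℤ._<_ (entry-low w pk) (entry-low w pi) lt))
  no-low-mid-low-descent _ () (low-barred _) (mid-plain _) (low-barred _) _

  high-avoids-312 : ∀ {p q r} → p ⊏ q → q ⊏ r →
    InLayer w p high → InLayer w q high → InLayer w r high → x q ℤ.< x r → x r ℤ.< x p → ⊥
  high-avoids-312 i<j j<k (high-plain pi) (high-plain pj) (high-plain pk) lt₁ lt₂ =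
    positives-avoid-312 w av312 i<j j<k pi pj pk
      (+[1+]-cancel-< (subst₂ ℤ._<_ (entry-high w pj) (entry-high w pk) lt₁))
      (+[1+]-cancel-< (subst₂ ℤ._<_ (entry-high w pk) (entry-high w pi) lt₂))

  low-avoids-231 : ∀ {p q r} → p ⊏ q → q ⊏ r →
    InLayer w p low → InLayer w q low → InLayer w r low → x r ℤ.< x p → x p ℤ.< x q → ⊥
  low-avoids-231 j<i k<j (low-barred pi) (low-barred pj) (low-barred pk) lt₁ lt₂ =
    positives-avoid-312 w av312 k<j j<i pk pj pi
      (drop‿-<- (subst₂ ℤ._<_ (entry-low w pi) (entry-low w pj) lt₂))
      (drop‿-<- (subst₂ ℤ._<_ (entry-low w pk) (entry-low w pi) lt₁))

  layering : Layering _⊏_ x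
  layering = record
    { _∈_ = InLayer w
    ; layer = inLayer w
    ; layer-mono = layer-mono
    ; no-high-before-low = no-high-before-low
    ; no-mid-ascent = no-mid-ascent
    ; no-high-mid-high-descent = no-high-mid-high-descent
    ; no-low-mid-low-descent = no-low-mid-low-descent
    ; high-avoids-312 = high-avoids-312
    ; low-avoids-231 = low-avoids-231
    }

lemma2p3 : ∀ (n : ℕ) (w : SignedPerm n) →
    AvoidsSigned w p1b2 → AvoidsSigned w pb21 → AvoidsSigned w pb2b1 →
    AvoidsSigned w p312 → AvoidsSigned w p3b12 →
    AvoidsUnsigned w u3412 × AvoidsUnsigned w u4231
lemma2p3 n w av1b2 avb21 avb2b1 av312 av3b12 =
  avoidsUnsigned-via-positions w u3412 (layering-avoids-3412 L) ,
  avoidsUnsigned-via-positions w u4231 (layering-avoids-4231 L)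
  where
  L : Layering _⊏_ (entry w)
  L = layering w av1b2 avb21 avb2b1 av312 av3b12
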